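{- Let $D,m_1,m_2$ be integers and let $H=(V,E)$ be a graph with $|V|\geqslant m_2+(2D+2)m_1$. If $H$ is a weak $(m_1,m_2)$-expander, then there exists a set $V'\subseteq V$ with $|V\setminus V'|\leqslant m_1$ such that $H[V']$ is an $(m_1,m_2,D)$-expander.
   Context: For a graph $F$ and $X\subseteq V(F)$, $N(X)=\bigcup_{x\in X}N(x)\setminus X$ denotes the external neighbourhood, and $e(X,Y)$ the number of edges between disjoint sets $X,Y$. A graph $F$ is a weak $(m_1,m_2)$-expander if $e(X,Y)>0$ for all disjoint $X,Y\subseteq V(F)$ with $|X|=m_1$ and $|Y|=m_2$. A graph $F$ is an $(m_1,m_2,D)$-expander if (i) $|N(X)|\geqslant D|X|+1$ for all $X\subseteq V(F)$ with $1\leqslant|X|\leqslant m_1$, and (ii) $e(X,Y)>0$ for all disjoint $X,Y\subseteq V(F)$ with $|X|=m_1$ and $|Y|=m_2$. -}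

module Defs where

open import Data.Nat using (ℕ; zero; suc; _+_; _*_; _≤_)
open import Data.Bool using (Bool; true; false; _∧_; _∨_; not; T)
open import Data.Fin using (Fin; zero; suc)
open import Data.Fin.Subset using (Subset; _∈_; _⊆_; ∣_∣; ∁; _∩_; Empty)
open import Data.Vec using (tabulate; lookup)
open import Data.Product using (Σ; ∃; _×_; _,_)
open import Relation.Binary.PropositionalEquality using (_≡_)

record Graph : Set where
  field
    n      : ℕ
    adj    : Fin n → Fin n → Bool
    sym    : ∀ u v → adj u v ≡ adj v u
    irrefl : ∀ v → adj v v ≡ false

open Graph public

anyFin : ∀ {k} → (Fin k → Bool) → Bool
anyFin {zero}  f = false
anyFin {suc k} f = f zero ∨ anyFin (λ i → f (suc i))

Disjoint : ∀ {k} → Subset k → Subset k → Set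
Disjoint X Y = Empty (X ∩ Y)

nbhdIn : (H : Graph) → Subset (n H) → Subset (n H) → Subset (n H)
nbhdIn H W X = tabulate λ v →
  lookup W v ∧ not (lookup X v) ∧ anyFin (λ x → lookup X x ∧ adj H x v)

EdgeBetween : (H : Graph) → Subset (n H) → Subset (n H) → Set
EdgeBetween H X Y = Σ (Fin (n H)) λ x → Σ (Fin (n H)) λ y →
  x ∈ X × y ∈ Y × T (adj H x y)

WeakExpander : (H : Graph) → ℕ → ℕ → Set
WeakExpander H m₁ m₂ = ∀ (X Y : Subset (n H)) → Disjoint X Y →
  ∣ X ∣ ≡ m₁ → ∣ Y ∣ ≡ m₂ → EdgeBetween H X Y

-- The induced subgraph H[W] is an (m1,m2,D)-expander
-- (all sets range over subsets of W; neighbourhoods are taken in H[W]).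
ExpanderOn : (H : Graph) → Subset (n H) → ℕ → ℕ → ℕ → Set
ExpanderOn H W m₁ m₂ D =
  (∀ (X : Subset (n H)) → X ⊆ W → 1 ≤ ∣ X ∣ → ∣ X ∣ ≤ m₁ →
     D * ∣ X ∣ + 1 ≤ ∣ nbhdIn H W X ∣)
  × (∀ (X Y : Subset (n H)) → X ⊆ W → Y ⊆ W → Disjoint X Y →
     ∣ X ∣ ≡ m₁ → ∣ Y ∣ ≡ m₂ → EdgeBetween H X Y)

module Submission where

-- Proof idea (greedy removal of poorly expanding sets).
--
-- Call B ⊆ V "removable" if |B| ≤ m₁ and |N(B)| ≤ D·|B|.  Starting from
-- B = ∅ we repeatedly look for a nonempty set X ⊆ V∖B with |X| ≤ m₁ whose
-- neighbourhood inside H[V∖B] has at most D·|X| vertices, and replace B by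
-- B ∪ X.  Since N(B ∪ X) ⊆ N(B) ∪ N_{H[V∖B]}(X), the union is again sparse;
-- its size is at most 2m₁, so |B ∪ X| + |N(B ∪ X)| ≤ (2D+2)m₁.  A weak
-- (m₁,m₂)-expander leaves fewer than m₂ vertices outside Z ∪ N(Z) for any
-- |Z| ≥ m₁, so with |V| ≥ m₂ + (2D+2)m₁ this forces |B ∪ X| < m₁.  Hence B
-- strictly grows and stays below m₁, so the process stops; when no such X
-- exists, V′ = V∖B satisfies the expansion condition (i) by construction,
-- and condition (ii) is inherited from H.

open import Defs
open import Data.Nat using (ℕ; zero; suc; _+_; _*_; _∸_; _≤_; _<_; z≤n; s≤s; _≤?_)
open import Data.Nat.Properties
open import Data.Nat.Tactic.RingSolver using (solve-∀)
open import Data.Bool using (Bool; true; false; _∧_; not; T)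
open import Data.Bool.Properties using (T-≡; T-∧; T-∨)
open import Data.Fin using (Fin; zero; suc)
open import Data.Fin.Subset using (Subset; ∣_∣; ∁; _∈_; _∉_; _⊆_; _∪_; ⊤; ⊥; inside; outside)
open import Data.Fin.Subset.Properties
  using (anySubset?; _⊆?_; out⊆; s⊆s; drop-∷-⊆; ∈⊤; ∉⊥; ∣p∣≤n; ∣p∣≤∣x∷p∣; ∣⊥∣≡0; ∣∁p∣≡n∸∣p∣;
         p⊆q⇒∣p∣≤∣q∣; x∈∁p⇒x∉p; x∉p⇒x∈∁p; x∈p∩q⁻; x∈p∪q⁻; x∈p∪q⁺; p⊆p∪q; q⊆p∪q)
open import Data.Vec using ([]; _∷_; here; lookup; tabulate)
open import Data.Vec.Properties using (lookup∘tabulate; []=⇒lookup; lookup⇒[]=)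
open import Data.Product using (Σ; _×_; _,_; proj₁; proj₂; ∃)
open import Data.Sum using (inj₁; inj₂)
open import Data.Unit using (tt)
open import Function.Bundles using (Equivalence)
open import Relation.Nullary using (¬_; Dec; yes; no; contradiction)
open import Relation.Nullary.Decidable using (_×-dec_)
open import Relation.Binary.PropositionalEquality using (_≡_; refl; trans; cong; subst; module ≡-Reasoning) renaming (sym to ≡-sym)

open Equivalence using (to; from)

∈⇒T : ∀ {k} {p : Subset k} {v : Fin k} → v ∈ p → T (lookup p v)
∈⇒T v∈p = from T-≡ ([]=⇒lookup v∈p)

T⇒∈ : ∀ {k} {p : Subset k} {v : Fin k} → T (lookup p v) → v ∈ p
T⇒∈ {p = p} {v} t = lookup⇒[]= v p (to T-≡ t)

∉⇒T-not : ∀ {k} {p : Subset k} {v : Fin k} → v ∉ p → T (not (lookup p v))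
∉⇒T-not {p = p} {v} v∉p with lookup p v in eq
... | true  = v∉p (lookup⇒[]= v p eq)
... | false = tt

T-not⇒∉ : ∀ {k} {p : Subset k} {v : Fin k} → T (not (lookup p v)) → v ∉ p
T-not⇒∉ t v∈p = subst (λ b → T (not b)) ([]=⇒lookup v∈p) t

∈-tabulate⁺ : ∀ {k} (f : Fin k → Bool) {v : Fin k} → T (f v) → v ∈ tabulate f
∈-tabulate⁺ f {v} t = T⇒∈ (subst T (≡-sym (lookup∘tabulate f v)) t)

∈-tabulate⁻ : ∀ {k} (f : Fin k → Bool) {v : Fin k} → v ∈ tabulate f → T (f v)
∈-tabulate⁻ f {v} v∈ = subst T (lookup∘tabulate f v) (∈⇒T v∈)

anyFin⁺ : ∀ {k} (f : Fin k → Bool) (i : Fin k) → T (f i) → T (anyFin f)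
anyFin⁺ f zero    t = from T-∨ (inj₁ t)
anyFin⁺ f (suc i) t = from T-∨ (inj₂ (anyFin⁺ (λ j → f (suc j)) i t))

anyFin⁻ : ∀ {k} (f : Fin k → Bool) → T (anyFin f) → ∃ λ i → T (f i)
anyFin⁻ {zero}  f ()
anyFin⁻ {suc k} f t with to T-∨ t
... | inj₁ t₀ = zero , t₀
... | inj₂ t′ with anyFin⁻ (λ j → f (suc j)) t′
...   | i , tᵢ = suc i , tᵢ

subset-of-size : ∀ {k} (p : Subset k) (m : ℕ) → m ≤ ∣ p ∣ → Σ (Subset k) λ q → q ⊆ p × ∣ q ∣ ≡ m
subset-of-size []            zero    _ = [] , (λ x → x) , refl
subset-of-size (outside ∷ p) m       h with subset-of-size p m h
... | q , q⊆p , ∣q∣≡m = outside ∷ q , out⊆ q⊆p , ∣q∣≡m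
subset-of-size (inside ∷ p)  zero    _ with subset-of-size p zero z≤n
... | q , q⊆p , ∣q∣≡0 = outside ∷ q , out⊆ q⊆p , ∣q∣≡0
subset-of-size (inside ∷ p)  (suc m) (s≤s h) with subset-of-size p m h
... | q , q⊆p , ∣q∣≡m = inside ∷ q , s⊆s q⊆p , cong suc ∣q∣≡m

∣p∪q∣≤∣p∣+∣q∣ : ∀ {k} (p q : Subset k) → ∣ p ∪ q ∣ ≤ ∣ p ∣ + ∣ q ∣
∣p∪q∣≤∣p∣+∣q∣ []            []            = z≤n
∣p∪q∣≤∣p∣+∣q∣ (inside ∷ p)  (s ∷ q)       = s≤s (≤-trans (∣p∪q∣≤∣p∣+∣q∣ p q) (+-monoʳ-≤ ∣ p ∣ (∣p∣≤∣x∷p∣ s q)))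
∣p∪q∣≤∣p∣+∣q∣ (outside ∷ p) (inside ∷ q)  = subst (suc ∣ p ∪ q ∣ ≤_) (≡-sym (+-suc ∣ p ∣ ∣ q ∣)) (s≤s (∣p∪q∣≤∣p∣+∣q∣ p q))
∣p∪q∣≤∣p∣+∣q∣ (outside ∷ p) (outside ∷ q) = ∣p∪q∣≤∣p∣+∣q∣ p q

∣p∪q∣≡∣p∣+∣q∣ : ∀ {k} (p q : Subset k) → q ⊆ ∁ p → ∣ p ∪ q ∣ ≡ ∣ p ∣ + ∣ q ∣
∣p∪q∣≡∣p∣+∣q∣ []            []            _   = refl
∣p∪q∣≡∣p∣+∣q∣ (inside ∷ p)  (inside ∷ q)  q⊆∁p = contradiction (q⊆∁p here) λ ()
∣p∪q∣≡∣p∣+∣q∣ (inside ∷ p)  (outside ∷ q) q⊆∁p = cong suc (∣p∪q∣≡∣p∣+∣q∣ p q (drop-∷-⊆ q⊆∁p))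
∣p∪q∣≡∣p∣+∣q∣ (outside ∷ p) (inside ∷ q)  q⊆∁p =
  trans (cong suc (∣p∪q∣≡∣p∣+∣q∣ p q (drop-∷-⊆ q⊆∁p))) (≡-sym (+-suc ∣ p ∣ ∣ q ∣))
∣p∪q∣≡∣p∣+∣q∣ (outside ∷ p) (outside ∷ q) q⊆∁p = ∣p∪q∣≡∣p∣+∣q∣ p q (drop-∷-⊆ q⊆∁p)

∣p∣+∣∁p∣≡n : ∀ {k} (p : Subset k) → ∣ p ∣ + ∣ ∁ p ∣ ≡ k
∣p∣+∣∁p∣≡n p = trans (cong (∣ p ∣ +_) (∣∁p∣≡n∸∣p∣ p)) (m+[n∸m]≡n (∣p∣≤n p))

∣∁∁p∣≡∣p∣ : ∀ {k} (p : Subset k) → ∣ ∁ (∁ p) ∣ ≡ ∣ p ∣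
∣∁∁p∣≡∣p∣ {k} p = begin
  ∣ ∁ (∁ p) ∣       ≡⟨ ∣∁p∣≡n∸∣p∣ (∁ p) ⟩
  k ∸ ∣ ∁ p ∣       ≡⟨ cong (k ∸_) (∣∁p∣≡n∸∣p∣ p) ⟩
  k ∸ (k ∸ ∣ p ∣)   ≡⟨ m∸[m∸n]≡n (∣p∣≤n p) ⟩
  ∣ p ∣             ∎
  where open ≡-Reasoning

module Neighbourhoods (H : Graph) where

  N : Subset (n H) → Subset (n H)
  N X = nbhdIn H ⊤ X

  ∈nbhd⁺ : ∀ W X {v} (x : Fin (n H)) → v ∈ W → v ∉ X → x ∈ X → T (adj H x v) → v ∈ nbhdIn H W X
  ∈nbhd⁺ W X {v} x v∈W v∉X x∈X x~v =
    ∈-tabulate⁺ _ (from T-∧ (∈⇒T v∈W , from T-∧ (∉⇒T-not v∉X ,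
      anyFin⁺ (λ y → lookup X y ∧ adj H y v) x (from T-∧ (∈⇒T x∈X , x~v)))))

  ∈nbhd⁻ : ∀ W X {v} → v ∈ nbhdIn H W X →
           v ∈ W × v ∉ X × ∃ λ x → x ∈ X × T (adj H x v)
  ∈nbhd⁻ W X {v} v∈N with to T-∧ (∈-tabulate⁻ _ v∈N)
  ... | v∈W , rest with to T-∧ rest
  ...   | v∉X , some with anyFin⁻ (λ y → lookup X y ∧ adj H y v) some
  ...     | x , x∈X∧x~v with to T-∧ x∈X∧x~v
  ...       | x∈X , x~v = T⇒∈ v∈W , T-not⇒∉ v∉X , x , T⇒∈ x∈X , x~v

  ∣N⊥∣≡0 : ∣ N ⊥ ∣ ≡ 0
  ∣N⊥∣≡0 = n≤0⇒n≡0 (subst (∣ N ⊥ ∣ ≤_) (∣⊥∣≡0 (n H)) (p⊆q⇒∣p∣≤∣q∣ N⊥⊆⊥))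
    where
    N⊥⊆⊥ : N ⊥ ⊆ ⊥
    N⊥⊆⊥ v∈N with ∈nbhd⁻ ⊤ ⊥ v∈N
    ... | _ , _ , _ , x∈⊥ , _ = contradiction x∈⊥ ∉⊥

  N-∪ : ∀ B X → N (B ∪ X) ⊆ N B ∪ nbhdIn H (∁ B) X
  N-∪ B X v∈N with ∈nbhd⁻ ⊤ (B ∪ X) v∈N
  ... | _ , v∉B∪X , x , x∈B∪X , x~v with x∈p∪q⁻ B X x∈B∪X
  ...   | inj₁ x∈B = x∈p∪q⁺ (inj₁ (∈nbhd⁺ ⊤ B x ∈⊤ v∉B x∈B x~v))
    where v∉B = λ v∈B → v∉B∪X (p⊆p∪q X v∈B)
  ...   | inj₂ x∈X = x∈p∪q⁺ (inj₂ (∈nbhd⁺ (∁ B) X x (x∉p⇒x∈∁p v∉B) v∉X x∈X x~v))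
    where
    v∉B = λ v∈B → v∉B∪X (p⊆p∪q X v∈B)
    v∉X = λ v∈X → v∉B∪X (q⊆p∪q B X v∈X)

  ∣N-∪∣ : ∀ B X → ∣ N (B ∪ X) ∣ ≤ ∣ N B ∣ + ∣ nbhdIn H (∁ B) X ∣
  ∣N-∪∣ B X = ≤-trans (p⊆q⇒∣p∣≤∣q∣ (N-∪ B X)) (∣p∪q∣≤∣p∣+∣q∣ (N B) (nbhdIn H (∁ B) X))

  no-edge-leaves-closed-nbhd : ∀ Z X Y → X ⊆ Z → Y ⊆ ∁ (Z ∪ N Z) → ¬ EdgeBetween H X Y
  no-edge-leaves-closed-nbhd Z X Y X⊆Z Y⊆R (x , y , x∈X , y∈Y , x~y) =
    y∉Z∪NZ (q⊆p∪q Z (N Z) (∈nbhd⁺ ⊤ Z x ∈⊤ (λ y∈Z → y∉Z∪NZ (p⊆p∪q (N Z) y∈Z)) (X⊆Z x∈X) x~y))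
    where
    y∉Z∪NZ : y ∉ Z ∪ N Z
    y∉Z∪NZ = x∈∁p⇒x∉p (Y⊆R y∈Y)

  -- In a weak (m₁,m₂)-expander, fewer than m₂ vertices lie outside Z ∪ N(Z)
  -- whenever |Z| ≥ m₁: otherwise m₁ vertices of Z and m₂ vertices outside
  -- Z ∪ N(Z) would span no edge.
  few-outside-closed-nbhd : ∀ {m₁ m₂} → WeakExpander H m₁ m₂ → ∀ Z → m₁ ≤ ∣ Z ∣ →
                            ¬ (m₂ ≤ ∣ ∁ (Z ∪ N Z) ∣)
  few-outside-closed-nbhd {m₁} {m₂} weak Z m₁≤∣Z∣ m₂≤∣R∣
    with subset-of-size Z m₁ m₁≤∣Z∣ | subset-of-size (∁ (Z ∪ N Z)) m₂ m₂≤∣R∣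
  ... | X , X⊆Z , ∣X∣≡m₁ | Y , Y⊆R , ∣Y∣≡m₂ =
    no-edge-leaves-closed-nbhd Z X Y X⊆Z Y⊆R (weak X Y disjoint ∣X∣≡m₁ ∣Y∣≡m₂)
    where
    disjoint : Disjoint X Y
    disjoint (v , v∈X∩Y) with x∈p∩q⁻ X Y v∈X∩Y
    ... | v∈X , v∈Y = x∈∁p⇒x∉p (Y⊆R v∈Y) (p⊆p∪q (N Z) (X⊆Z v∈X))

  large-sets-expand : ∀ {m₁ m₂} → WeakExpander H m₁ m₂ → ∀ Z → m₁ ≤ ∣ Z ∣ →
                      n H < (∣ Z ∣ + ∣ N Z ∣) + m₂
  large-sets-expand {m₁} {m₂} weak Z m₁≤∣Z∣ = begin-strict
    n H                                ≡⟨ ≡-sym (∣p∣+∣∁p∣≡n C) ⟩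
    ∣ C ∣ + ∣ ∁ C ∣                    <⟨ +-mono-≤-< (∣p∪q∣≤∣p∣+∣q∣ Z (N Z)) ∣∁C∣<m₂ ⟩
    (∣ Z ∣ + ∣ N Z ∣) + m₂             ∎
    where
    open ≤-Reasoning
    C = Z ∪ N Z
    ∣∁C∣<m₂ : ∣ ∁ C ∣ < m₂
    ∣∁C∣<m₂ = ≰⇒> (few-outside-closed-nbhd weak Z m₁≤∣Z∣)

closed-nbhd-bound : ∀ D m s t → s ≤ m + m → t ≤ D * s → s + t ≤ (2 * D + 2) * m
closed-nbhd-bound D m s t s≤2m t≤Ds = begin
  s + t                    ≤⟨ +-mono-≤ s≤2m (≤-trans t≤Ds (*-monoʳ-≤ D s≤2m)) ⟩
  (m + m) + D * (m + m)    ≡⟨ identity D m ⟩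
  (2 * D + 2) * m          ∎
  where
  open ≤-Reasoning
  identity : ∀ D m → (m + m) + D * (m + m) ≡ (2 * D + 2) * m
  identity = solve-∀

module Greedy (D m₁ m₂ : ℕ) (H : Graph)
              (large : m₂ + (2 * D + 2) * m₁ ≤ n H)
              (weak : WeakExpander H m₁ m₂) where

  open Neighbourhoods H

  Result : Set
  Result = Σ (Subset (n H)) λ V′ → (∣ ∁ V′ ∣ ≤ m₁) × ExpanderOn H V′ m₁ m₂ D

  record Removable (B : Subset (n H)) : Set where
    field
      small  : ∣ B ∣ ≤ m₁
      sparse : ∣ N B ∣ ≤ D * ∣ B ∣
  open Removable

  Violator : Subset (n H) → Subset (n H) → Set
  Violator B X = X ⊆ ∁ B × 1 ≤ ∣ X ∣ × ∣ X ∣ ≤ m₁ × ∣ nbhdIn H (∁ B) X ∣ ≤ D * ∣ X ∣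

  violator? : ∀ B X → Dec (Violator B X)
  violator? B X = (X ⊆? ∁ B) ×-dec (1 ≤? ∣ X ∣) ×-dec (∣ X ∣ ≤? m₁) ×-dec (∣ nbhdIn H (∁ B) X ∣ ≤? D * ∣ X ∣)

  no-small-closed-nbhd : ∀ Z → m₁ ≤ ∣ Z ∣ → ¬ (∣ Z ∣ + ∣ N Z ∣ ≤ (2 * D + 2) * m₁)
  no-small-closed-nbhd Z m₁≤∣Z∣ bound = <-irrefl refl (begin-strict
    m₂ + c                    ≤⟨ large ⟩
    n H                       <⟨ large-sets-expand weak Z m₁≤∣Z∣ ⟩
    (∣ Z ∣ + ∣ N Z ∣) + m₂    ≤⟨ +-monoˡ-≤ m₂ bound ⟩
    c + m₂                    ≡⟨ +-comm c m₂ ⟩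
    m₂ + c                    ∎)
    where
    open ≤-Reasoning
    c = (2 * D + 2) * m₁

  module Absorb {B X : Subset (n H)} (rem : Removable B) (viol : Violator B X) where

    X⊆∁B : X ⊆ ∁ B
    X⊆∁B = proj₁ viol

    ∣B∪X∣≡ : ∣ B ∪ X ∣ ≡ ∣ B ∣ + ∣ X ∣
    ∣B∪X∣≡ = ∣p∪q∣≡∣p∣+∣q∣ B X X⊆∁B

    grows : ∣ B ∣ < ∣ B ∪ X ∣
    grows = subst (∣ B ∣ <_) (≡-sym ∣B∪X∣≡)
                  (subst (_≤ ∣ B ∣ + ∣ X ∣) (+-comm ∣ B ∣ 1) (+-monoʳ-≤ ∣ B ∣ (proj₁ (proj₂ viol))))

    sparse∪ : ∣ N (B ∪ X) ∣ ≤ D * ∣ B ∪ X ∣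
    sparse∪ = begin
      ∣ N (B ∪ X) ∣                          ≤⟨ ∣N-∪∣ B X ⟩
      ∣ N B ∣ + ∣ nbhdIn H (∁ B) X ∣         ≤⟨ +-mono-≤ (sparse rem) (proj₂ (proj₂ (proj₂ viol))) ⟩
      D * ∣ B ∣ + D * ∣ X ∣                  ≡⟨ ≡-sym (*-distribˡ-+ D ∣ B ∣ ∣ X ∣) ⟩
      D * (∣ B ∣ + ∣ X ∣)                    ≡⟨ cong (D *_) (≡-sym ∣B∪X∣≡) ⟩
      D * ∣ B ∪ X ∣                          ∎
      where open ≤-Reasoning

    -- |B ∪ X| ≤ 2m₁, so reaching size m₁ would contradict no-small-closed-nbhd.
    small∪ : ∣ B ∪ X ∣ < m₁
    small∪ = ≰⇒> λ m₁≤ → no-small-closed-nbhd (B ∪ X) m₁≤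
                 (closed-nbhd-bound D m₁ ∣ B ∪ X ∣ ∣ N (B ∪ X) ∣ ≤2m₁ sparse∪)
      where
      ≤2m₁ : ∣ B ∪ X ∣ ≤ m₁ + m₁
      ≤2m₁ = subst (_≤ m₁ + m₁) (≡-sym ∣B∪X∣≡) (+-mono-≤ (small rem) (proj₁ (proj₂ (proj₂ viol))))

    absorb : Removable (B ∪ X)
    absorb = record { small = <⇒≤ small∪ ; sparse = sparse∪ }

  finish : ∀ B → Removable B → ¬ ∃ (Violator B) → Result
  finish B rem none = ∁ B , subst (_≤ m₁) (≡-sym (∣∁∁p∣≡∣p∣ B)) (small rem) , expands , λ X Y _ _ → weak X Y
    where
    expands : ∀ X → X ⊆ ∁ B → 1 ≤ ∣ X ∣ → ∣ X ∣ ≤ m₁ → D * ∣ X ∣ + 1 ≤ ∣ nbhdIn H (∁ B) X ∣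
    expands X X⊆∁B 1≤∣X∣ ∣X∣≤m₁ =
      subst (_≤ ∣ nbhdIn H (∁ B) X ∣) (+-comm 1 (D * ∣ X ∣))
            (≰⇒> λ few → none (X , X⊆∁B , 1≤∣X∣ , ∣X∣≤m₁ , few))

  -- Absorb violators while they exist; B grows strictly and stays below m₁,
  -- so m₁ steps of fuel suffice.
  greedy : ∀ k B → Removable B → m₁ ≤ ∣ B ∣ + k → Result
  greedy k B rem fuel with anySubset? (violator? B)
  ... | no none          = finish B rem none
  ... | yes (X , viol)   = continue k fuel
    where
    open Absorb rem viol
    continue : ∀ j → m₁ ≤ ∣ B ∣ + j → Result
    continue zero    fuel′ = contradiction (≤-trans (subst (m₁ ≤_) (+-identityʳ ∣ B ∣) fuel′) (<⇒≤ grows))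
                                           (<⇒≱ small∪)
    continue (suc j) fuel′ = greedy j (B ∪ X) absorb
      (≤-trans fuel′ (subst (_≤ ∣ B ∪ X ∣ + j) (≡-sym (+-suc ∣ B ∣ j)) (+-monoˡ-≤ j grows)))

  ∅ : Subset (n H)
  ∅ = ⊥

  removable-∅ : Removable ∅
  removable-∅ = record
    { small  = subst (_≤ m₁) (≡-sym (∣⊥∣≡0 (n H))) z≤n
    ; sparse = subst (_≤ D * ∣ ∅ ∣) (≡-sym ∣N⊥∣≡0) z≤n
    }

proposition4p2 : (D m₁ m₂ : ℕ) (H : Graph) →
    m₂ + (2 * D + 2) * m₁ ≤ n H →
    WeakExpander H m₁ m₂ →
    Σ (Subset (n H)) λ V′ → (∣ ∁ V′ ∣ ≤ m₁) × ExpanderOn H V′ m₁ m₂ D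
proposition4p2 D m₁ m₂ H large weak = greedy m₁ ∅ removable-∅ (m≤n+m m₁ ∣ ∅ ∣)
  where open Greedy D m₁ m₂ H large weak
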